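{- Assume the Inverse Shortcode Hypothesis (ISH) holds. Then the Degree 2 Shortcode Soundness Hypothesis (SSH) holds. (ISH): For every $\eta>0$ there exist $\delta>0$ and an integer $r$, depending only on $\eta$, such that for all $\ell,n$ and every subset $S\subseteq \mathsf{Mat}_{\ell,n}$: if $\Pr_{M\sim S,\,a\sim\mathbb{F}_2^{\ell},\,b\sim\mathbb{F}_2^{n}}[M+ab^{\top}\in S]\ge \eta$ (all samples uniform and independent), then there exists an $r$-nice set $T\subseteq\mathsf{Mat}_{\ell,n}$ with $|S\cap T|\ge \delta|T|$. (SSH): For every $\delta>0$ there exist $\epsilon>0$ and an integer $r>0$ such that the following holds for sufficiently large $n\gg\ell$. Let $F:\mathsf{Mat}_{\ell,n}\to\mathbb{F}_2^{\ell}$ satisfy $\Pr_{M\sim\mathsf{Mat}_{\ell,n},\,a\sim\mathbb{F}_2^{\ell},\,b\sim\mathbb{F}_2^{n}}[F(M+ab^{\top})\in\{F(M),F(M)+a\}]\ge\delta$. Then there exist $q_1,\dots,q_r\in\mathbb{F}_2^n$, $t_1,\dots,t_r\in\mathbb{F}_2^{\ell}$, $p_1,\dots,p_r\in\mathbb{F}_2^{\ell}$, $s_1,\dots,s_r\in\mathbb{F}_2^{n}$, $z\in\mathbb{F}_2^n$ and $u\in\mathbb{F}_2^{\ell}$ such that $$\Pr_{M\sim\mathsf{Mat}_{\ell,n}}\big[F(M)=Mz+u \;\big|\; Mq_i=t_i,\ p_i^{\top}M=s_i^{\top}\ \forall i\le r\big]\ge\epsilon.$$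
   Context: $\mathsf{Mat}_{\ell,n}$ denotes the set of all $\ell\times n$ matrices over $\mathbb{F}_2$; $M\sim X$ means $M$ is drawn uniformly from the finite set $X$. A right affine subspace of $\mathsf{Mat}_{\ell,n}$ is a set of the form $\{M: Mq_i=t_i,\ i=1,\dots,r_1\}$ with $q_i\in\mathbb{F}_2^n$, $t_i\in\mathbb{F}_2^{\ell}$; a left affine subspace is a set of the form $\{M: s_j^{\top}M=u_j^{\top},\ j=1,\dots,r_2\}$ with $s_j\in\mathbb{F}_2^{\ell}$, $u_j\in\mathbb{F}_2^n$. A subset $T\subseteq\mathsf{Mat}_{\ell,n}$ is $r$-nice if it is the intersection of a right affine subspace defined by $r_1$ such constraints and a left affine subspace defined by $r_2$ such constraints with $r_1+r_2=r$.
   Formalization: In the Degree 2 Shortcode Soundness Hypothesis the parameter δ ranges only over the positive rationals; η, ε and the δ of the Inverse Shortcode Hypothesis are also taken in ℚ. -}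

module Defs where

open import Data.Bool using (Bool; true; false; _∧_; _∨_; _xor_; if_then_else_)
open import Data.Nat using (ℕ; zero; suc; _+_; _≤_; _<_)
open import Data.Integer using (+_)
open import Data.List using (List; []; _∷_; concatMap; map)
open import Data.Vec using (Vec; []; _∷_; zipWith; foldr; transpose)
  renaming (map to vmap)
open import Data.Rational using (ℚ; _/_; 0ℚ) renaming (_*_ to _*ℚ_; _≤_ to _≤ℚ_; _<_ to _<ℚ_)
open import Data.Product using (Σ; ∃; _×_; _,_)
open import Relation.Binary.PropositionalEquality using (_≡_)

-- 𝔽₂ is Bool, with addition = xor and multiplication = ∧.
F2 : Set
F2 = Bool

V : ℕ → Set
V n = Vec F2 n

Mat : ℕ → ℕ → Set
Mat ℓ n = Vec (V n) ℓ

eqB : F2 → F2 → Bool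
eqB true  true  = true
eqB false false = true
eqB _     _     = false

eqV : ∀ {n} → V n → V n → Bool
eqV []       []       = true
eqV (x ∷ xs) (y ∷ ys) = eqB x y ∧ eqV xs ys

vadd : ∀ {n} → V n → V n → V n
vadd = zipWith _xor_

dot : ∀ {n} → V n → V n → F2
dot x y = foldr (λ _ → F2) _xor_ false (zipWith _∧_ x y)

mulV : ∀ {ℓ n} → Mat ℓ n → V n → V ℓ
mulV M q = vmap (λ row → dot row q) M

vMul : ∀ {ℓ n} → V ℓ → Mat ℓ n → V n
vMul s M = vmap (dot s) (transpose M)

outer : ∀ {ℓ n} → V ℓ → V n → Mat ℓ n
outer a b = vmap (λ ai → vmap (ai ∧_) b) a

madd : ∀ {ℓ n} → Mat ℓ n → Mat ℓ n → Mat ℓ n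
madd = zipWith vadd

-- Enumerations of 𝔽₂^n and Mat_{ℓ,n} (each element exactly once).
allV : (n : ℕ) → List (V n)
allV zero    = [] ∷ []
allV (suc n) = concatMap (λ v → (false ∷ v) ∷ (true ∷ v) ∷ []) (allV n)

allMat : (ℓ n : ℕ) → List (Mat ℓ n)
allMat zero    n = [] ∷ []
allMat (suc ℓ) n = concatMap (λ M → map (_∷ M) (allV n)) (allMat ℓ n)

sumL : {A : Set} → List A → (A → ℕ) → ℕ
sumL []       f = 0
sumL (x ∷ xs) f = f x + sumL xs f

ind : Bool → ℕ
ind b = if b then 1 else 0

count : {A : Set} → List A → (A → Bool) → ℕ
count xs P = sumL xs (λ x → ind (P x))

allB : ∀ {k} → Vec Bool k → Bool
allB = foldr (λ _ → Bool) _∧_ true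

ℕ→ℚ : ℕ → ℚ
ℕ→ℚ k = + k / 1

Subset : ℕ → ℕ → Set
Subset ℓ n = Mat ℓ n → Bool

niceMem : ∀ {ℓ n r₁ r₂} → Vec (V n) r₁ → Vec (V ℓ) r₁ →
          Vec (V ℓ) r₂ → Vec (V n) r₂ → Mat ℓ n → Bool
niceMem q t s u M =
  allB (zipWith (λ qi ti → eqV (mulV M qi) ti) q t) ∧
  allB (zipWith (λ sj uj → eqV (vMul sj M) uj) s u)

IsNice : ℕ → ∀ {ℓ n} → Subset ℓ n → Set
IsNice r {ℓ} {n} T =
  Σ ℕ λ r₁ → Σ ℕ λ r₂ → (r₁ + r₂ ≡ r) ×
  Σ (Vec (V n) r₁) λ q → Σ (Vec (V ℓ) r₁) λ t →
  Σ (Vec (V ℓ) r₂) λ s → Σ (Vec (V n) r₂) λ u →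
  (∀ M → T M ≡ niceMem q t s u M)

card : ∀ {ℓ n} → Subset ℓ n → ℕ
card {ℓ} {n} S = count (allMat ℓ n) S

-- Number of triples (M, a, b) ∈ S × 𝔽₂^ℓ × 𝔽₂^n with M + a bᵀ ∈ S.
-- The probability in ISH is  shortcodeHits S / (|S| · 2^ℓ · 2^n),
-- and  |S| · 2^ℓ · 2^n = shortcodeTotal S.
shortcodeHits : ∀ {ℓ n} → Subset ℓ n → ℕ
shortcodeHits {ℓ} {n} S =
  sumL (allMat ℓ n) λ M → sumL (allV ℓ) λ a → sumL (allV n) λ b →
    ind (S M ∧ S (madd M (outer a b)))

shortcodeTotal : ∀ {ℓ n} → Subset ℓ n → ℕ
shortcodeTotal {ℓ} {n} S =
  sumL (allMat ℓ n) λ M → sumL (allV ℓ) λ a → sumL (allV n) λ b → ind (S M)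

-- Inverse Shortcode Hypothesis.
-- (S is required nonempty, since M ~ S must make sense; T is required nonempty,
-- as otherwise |S ∩ T| ≥ δ|T| is vacuous.)
ISH : Set
ISH =
  ∀ (η : ℚ) → 0ℚ <ℚ η →
  Σ ℚ λ δ → (0ℚ <ℚ δ) × Σ ℕ λ r →
  ∀ (ℓ n : ℕ) (S : Subset ℓ n) →
    0 < card S →
    η *ℚ ℕ→ℚ (shortcodeTotal S) ≤ℚ ℕ→ℚ (shortcodeHits S) →
    Σ (Subset ℓ n) λ T → IsNice r T × (0 < card T) ×
      (δ *ℚ ℕ→ℚ (card T) ≤ℚ ℕ→ℚ (card (λ M → S M ∧ T M)))

degree2Hits : ∀ {ℓ n} → (Mat ℓ n → V ℓ) → ℕ
degree2Hits {ℓ} {n} F =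
  sumL (allMat ℓ n) λ M → sumL (allV ℓ) λ a → sumL (allV n) λ b →
    ind (eqV (F (madd M (outer a b))) (F M) ∨
         eqV (F (madd M (outer a b))) (vadd (F M) a))

allTriples : ℕ → ℕ → ℕ
allTriples ℓ n =
  sumL (allMat ℓ n) λ M → sumL (allV ℓ) λ a → sumL (allV n) λ b → 1

condEvent : ∀ {ℓ n r} → Vec (V n) r → Vec (V ℓ) r → Vec (V ℓ) r → Vec (V n) r →
            Mat ℓ n → Bool
condEvent q t p s M =
  allB (zipWith (λ qi ti → eqV (mulV M qi) ti) q t) ∧
  allB (zipWith (λ pi si → eqV (vMul pi M) si) p s)

-- Degree 2 Shortcode Soundness Hypothesis.
-- "for sufficiently large n ≫ ℓ" is read as: there is a threshold N : ℕ → ℕ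
-- (depending on δ) such that the claim holds for all ℓ and all n ≥ N ℓ.
-- The conditional probability Pr[A | C] ≥ ε is read as: C is nonempty and
-- ε · |C| ≤ |A ∩ C|.
SSH : Set
SSH =
  ∀ (δ : ℚ) → 0ℚ <ℚ δ →
  Σ ℚ λ ε → (0ℚ <ℚ ε) × Σ ℕ λ r → (0 < r) ×
  Σ (ℕ → ℕ) λ N →
  ∀ (ℓ n : ℕ) → N ℓ ≤ n →
  ∀ (F : Mat ℓ n → V ℓ) →
    δ *ℚ ℕ→ℚ (allTriples ℓ n) ≤ℚ ℕ→ℚ (degree2Hits F) →
    Σ (Vec (V n) r) λ q → Σ (Vec (V ℓ) r) λ t →
    Σ (Vec (V ℓ) r) λ p → Σ (Vec (V n) r) λ s →
    Σ (V n) λ z → Σ (V ℓ) λ u →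
      (0 < count (allMat ℓ n) (condEvent q t p s)) ×
      (ε *ℚ ℕ→ℚ (count (allMat ℓ n) (condEvent q t p s))
        ≤ℚ ℕ→ℚ (count (allMat ℓ n)
                  (λ M → condEvent q t p s M ∧ eqV (F M) (vadd (mulV M z) u))))

-- Reduction from the graph of F.  Let S ⊆ Mat_{ℓ,n+1} be the set of matrices [F(M) | M].  Shifting
-- [y | M] by a (β, b)ᵀ gives [y + β a | M + a bᵀ], so S passes the shortcode test whenever F passes the
-- degree-2 test with β = 0 or β = 1; since β is a fresh random bit, the acceptance probability is at
-- least δ/2.  ISH then gives an r-nice set T in which S has density ε.  If a right constraint of T
-- has first coordinate 1, it pins the first column to y = M z + u; substituting this into the other
-- constraints describes S ∩ T as the set of M satisfying nice conditions on which F(M) = M z + u.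
-- Otherwise the first column is constrained independently of M, and the best constant u (with z = 0)
-- agrees with F on the remaining conditions at least as often as an average admissible first column.

module Submission where

open import Defs
import Algebra.Properties.CommutativeSemigroup as CommSemigroupProperties
open import Data.Bool using (Bool; true; false; not; _∧_; _∨_; _xor_; if_then_else_)
open import Data.Bool.Properties
  using (∧-assoc; ∧-zeroʳ; ∧-identityʳ; ∧-conical; xor-identityʳ; xor-∧-commutativeRing)
open import Data.Empty using (⊥-elim)
import Data.Integer as ℤ
import Data.Integer.Properties as ℤₚ
open import Data.List as List using (List; []; _∷_)
open import Data.Maybe using (nothing)
open import Data.Nat using (ℕ; zero; suc; _+_; _*_; _≤_; _<_; z≤n; s≤s)
open import Data.Nat.Coprimality as Coprime using (1-coprimeTo)
open import Data.Nat.Properties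
  using (≤-refl; ≤-reflexive; ≤-trans; ≤-total; +-mono-≤; *-monoʳ-≤; +-identityʳ; *-zeroʳ;
         *-identityˡ; *-distribʳ-+; *-distribˡ-+; +-assoc; m≤m+n; n≮0; +-commutativeSemigroup)
open import Data.Product using (Σ; ∃; ∃₂; _×_; _,_; proj₁; proj₂)
open import Data.Rational
  using (ℚ; mkℚ; *≤*; _/_; 0ℚ; 1ℚ; ½; Positive; positive)
  renaming (_*_ to _*ℚ_; _≤_ to _≤ℚ_; _<_ to _<ℚ_)
import Data.Rational.Properties as ℚ
open import Data.Sum as Sum using (_⊎_; inj₁; inj₂; [_,_]′)
open import Data.Vec using (Vec; []; _∷_; zipWith; transpose; replicate; head; tail; _++_)
  renaming (map to vmap)
open import Data.Vec.Properties using (map-cong; map-const; zipWith-is-⊛; ∷-injectiveˡ; ∷-injectiveʳ)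
open import Data.Vec.Relation.Unary.All using (All; []; _∷_)
open import Function using (_∘_)
open import Level using (0ℓ)
open import Relation.Binary.PropositionalEquality
  using (_≡_; refl; sym; trans; cong; cong₂; subst; subst₂; module ≡-Reasoning)
open import Tactic.RingSolver using (solve-∀)
open import Tactic.RingSolver.Core.AlmostCommutativeRing using (AlmostCommutativeRing; fromCommutativeRing)

ℕ→ℚ≡mkℚ : ∀ k → ℕ→ℚ k ≡ mkℚ (ℤ.+ k) 0 (Coprime.sym (1-coprimeTo k))
ℕ→ℚ≡mkℚ k = ℚ.↥p/↧p≡p _

ℕ→ℚ-* : ∀ a b → ℕ→ℚ (a * b) ≡ ℕ→ℚ a *ℚ ℕ→ℚ b
ℕ→ℚ-* a b rewrite ℕ→ℚ≡mkℚ a | ℕ→ℚ≡mkℚ b = cong (_/ 1) (ℤₚ.pos-* a b)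

ℕ→ℚ-mono-≤ : ∀ {a b} → a ≤ b → ℕ→ℚ a ≤ℚ ℕ→ℚ b
ℕ→ℚ-mono-≤ {a} {b} a≤b rewrite ℕ→ℚ≡mkℚ a | ℕ→ℚ≡mkℚ b =
  *≤* (subst₂ ℤ._≤_ (sym (ℤₚ.*-identityʳ (ℤ.+ a))) (sym (ℤₚ.*-identityʳ (ℤ.+ b))) (ℤ.+≤+ a≤b))

ℕ→ℚ-positive : ∀ k → Positive (ℕ→ℚ (suc k))
ℕ→ℚ-positive k rewrite ℕ→ℚ≡mkℚ (suc k) = _

ℕ→ℚ-*-cancelˡ-≤ : ∀ ε k c a → ε *ℚ ℕ→ℚ (suc k * c) ≤ℚ ℕ→ℚ (suc k * a) → ε *ℚ ℕ→ℚ c ≤ℚ ℕ→ℚ a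
ℕ→ℚ-*-cancelˡ-≤ ε k c a h rewrite ℕ→ℚ-* (suc k) c | ℕ→ℚ-* (suc k) a =
  ℚ.*-cancelˡ-≤-pos K {{ℕ→ℚ-positive k}}
    (subst (_≤ℚ K *ℚ ℕ→ℚ a) ε[Kc]≡K[εc] h)
  where
  K : ℚ
  K = ℕ→ℚ (suc k)
  ε[Kc]≡K[εc] : ε *ℚ (K *ℚ ℕ→ℚ c) ≡ K *ℚ (ε *ℚ ℕ→ℚ c)
  ε[Kc]≡K[εc] = trans (sym (ℚ.*-assoc ε K _)) (trans (cong (_*ℚ ℕ→ℚ c) (ℚ.*-comm ε K)) (ℚ.*-assoc K ε _))

density-cancelˡ : ∀ {ε N H} k c a → 0 < N → ε *ℚ ℕ→ℚ N ≤ℚ ℕ→ℚ H → N ≡ k * c → H ≤ k * a →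
  0 < c × ε *ℚ ℕ→ℚ c ≤ℚ ℕ→ℚ a
density-cancelˡ zero    c       a 0<N _     N≡kc _    = ⊥-elim (n≮0 (subst (0 <_) N≡kc 0<N))
density-cancelˡ (suc k) zero    a 0<N _     N≡kc _    = ⊥-elim (n≮0 (subst (0 <_) (trans N≡kc (*-zeroʳ k)) 0<N))
density-cancelˡ {ε} (suc k) (suc c) a 0<N dense N≡kc H≤ka = s≤s z≤n ,
  ℕ→ℚ-*-cancelˡ-≤ ε k (suc c) a (ℚ.≤-trans (subst (λ m → ε *ℚ ℕ→ℚ m ≤ℚ _) N≡kc dense) (ℕ→ℚ-mono-≤ H≤ka))

half-of-double : ∀ δ x → (δ *ℚ ½) *ℚ ℕ→ℚ (2 * x) ≡ δ *ℚ ℕ→ℚ x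
half-of-double δ x = begin
  (δ *ℚ ½) *ℚ ℕ→ℚ (2 * x)          ≡⟨ cong ((δ *ℚ ½) *ℚ_) (ℕ→ℚ-* 2 x) ⟩
  (δ *ℚ ½) *ℚ (ℕ→ℚ 2 *ℚ ℕ→ℚ x)     ≡⟨ ℚ.*-assoc δ ½ _ ⟩
  δ *ℚ (½ *ℚ (ℕ→ℚ 2 *ℚ ℕ→ℚ x))     ≡⟨ cong (δ *ℚ_) (sym (ℚ.*-assoc ½ (ℕ→ℚ 2) (ℕ→ℚ x))) ⟩
  δ *ℚ ((½ *ℚ ℕ→ℚ 2) *ℚ ℕ→ℚ x)      ≡⟨⟩
  δ *ℚ (1ℚ *ℚ ℕ→ℚ x)                ≡⟨ cong (δ *ℚ_) (ℚ.*-identityˡ (ℕ→ℚ x)) ⟩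
  δ *ℚ ℕ→ℚ x                        ∎
  where open ≡-Reasoning

half-positive : ∀ δ → 0ℚ <ℚ δ → 0ℚ <ℚ δ *ℚ ½
half-positive δ 0<δ = ℚ.positive⁻¹ _ {{ℚ.pos*pos⇒pos δ {{positive 0<δ}} ½}}

𝔽₂ : AlmostCommutativeRing 0ℓ 0ℓ
𝔽₂ = fromCommutativeRing xor-∧-commutativeRing (λ _ → nothing)

eqB≡not-xor : ∀ a b → eqB a b ≡ not (a xor b)
eqB≡not-xor true  true  = refl
eqB≡not-xor true  false = refl
eqB≡not-xor false true  = refl
eqB≡not-xor false false = refl

eqB-refl : ∀ a → eqB a a ≡ true
eqB-refl true  = refl
eqB-refl false = refl

eqB-sound : ∀ {a b} → eqB a b ≡ true → a ≡ b
eqB-sound {true}  {true}  _  = refl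
eqB-sound {true}  {false} ()
eqB-sound {false} {true}  ()
eqB-sound {false} {false} _  = refl

ind-∧ : ∀ a b → ind (a ∧ b) ≡ ind a * ind b
ind-∧ true  b = sym (+-identityʳ (ind b))
ind-∧ false b = refl

ind-∨ : ∀ a b → ind (a ∨ b) ≤ ind a + ind b
ind-∨ true  b = s≤s z≤n
ind-∨ false b = ≤-refl

∧-congˡ-if : ∀ {a a′ b} → (b ≡ true → a ≡ a′) → a ∧ b ≡ a′ ∧ b
∧-congˡ-if {a} {a′} {false} _ = trans (∧-zeroʳ a) (sym (∧-zeroʳ a′))
∧-congˡ-if {b = true} a≡a′ = cong (_∧ true) (a≡a′ refl)

≡-∧-cases : ∀ {a e c} → (e ≡ true → a ≡ c) → (e ≡ false → a ≡ false) → a ≡ e ∧ c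
≡-∧-cases {e = true}  a≡c _   = a≡c refl
≡-∧-cases {e = false} _   a≡f = a≡f refl

∧-rotate : ∀ a b c → a ∧ (b ∧ c) ≡ b ∧ (c ∧ a)
∧-rotate = solve-∀ 𝔽₂

∧-swap : ∀ a b c → a ∧ (b ∧ c) ≡ b ∧ (a ∧ c)
∧-swap = solve-∀ 𝔽₂

∧-interchange : ∀ a b c d → (a ∧ b) ∧ (c ∧ d) ≡ (a ∧ c) ∧ (b ∧ d)
∧-interchange = solve-∀ 𝔽₂

zeros : ∀ n → V n
zeros n = replicate n false

vadd-identityˡ : ∀ {n} (v : V n) → vadd (zeros n) v ≡ v
vadd-identityˡ []      = refl
vadd-identityˡ (x ∷ v) = cong (x ∷_) (vadd-identityˡ v)

vadd-rotate : ∀ {n} (a b c : V n) → vadd (vadd a b) c ≡ vadd (vadd b c) a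
vadd-rotate []       []       []       = refl
vadd-rotate (a ∷ as) (b ∷ bs) (c ∷ cs) = cong₂ _∷_ (rotate a b c) (vadd-rotate as bs cs)
  where
  rotate : ∀ a b c → (a xor b) xor c ≡ (b xor c) xor a
  rotate = solve-∀ 𝔽₂

vadd-shuffle : ∀ {n} (a b c d : V n) → vadd (vadd a b) (vadd c d) ≡ vadd (vadd (vadd b d) a) c
vadd-shuffle []       []       []       []       = refl
vadd-shuffle (a ∷ as) (b ∷ bs) (c ∷ cs) (d ∷ ds) = cong₂ _∷_ (shuffle a b c d) (vadd-shuffle as bs cs ds)
  where
  shuffle : ∀ a b c d → (a xor b) xor (c xor d) ≡ ((b xor d) xor a) xor c
  shuffle = solve-∀ 𝔽₂

eqV-refl : ∀ {n} (v : V n) → eqV v v ≡ true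
eqV-refl []      = refl
eqV-refl (x ∷ v) = cong₂ _∧_ (eqB-refl x) (eqV-refl v)

eqV-sound : ∀ {n} {a b : V n} → eqV a b ≡ true → a ≡ b
eqV-sound {a = []}     {[]}     _  = refl
eqV-sound {a = x ∷ a} {y ∷ b} eq =
  cong₂ _∷_ (eqB-sound (proj₁ ∧-conical _ _ eq)) (eqV-sound (proj₂ ∧-conical _ _ eq))

eqV-cong-vadd : ∀ {n} {a b c d : V n} → vadd a b ≡ vadd c d → eqV a b ≡ eqV c d
eqV-cong-vadd {a = []}     {[]}     {[]}     {[]}     _  = refl
eqV-cong-vadd {a = a ∷ as} {b ∷ bs} {c ∷ cs} {d ∷ ds} eq = cong₂ _∧_
  (trans (eqB≡not-xor a b) (trans (cong not (∷-injectiveˡ eq)) (sym (eqB≡not-xor c d))))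
  (eqV-cong-vadd (∷-injectiveʳ eq))

dot-zerosˡ : ∀ {n} (x : V n) → dot (zeros n) x ≡ false
dot-zerosˡ []      = refl
dot-zerosˡ (_ ∷ x) = dot-zerosˡ x

dot-zerosʳ : ∀ {n} (x : V n) → dot x (zeros n) ≡ false
dot-zerosʳ []      = refl
dot-zerosʳ (a ∷ x) = cong₂ _xor_ (∧-zeroʳ a) (dot-zerosʳ x)

dot-vaddˡ : ∀ {n} (a b z : V n) → dot (vadd a b) z ≡ dot a z xor dot b z
dot-vaddˡ []       []       []       = refl
dot-vaddˡ (a ∷ as) (b ∷ bs) (z ∷ zs) =
  trans (cong (((a xor b) ∧ z) xor_) (dot-vaddˡ as bs zs)) (distrib a b z _ _)
  where
  distrib : ∀ a b z d e → ((a xor b) ∧ z) xor (d xor e) ≡ ((a ∧ z) xor d) xor ((b ∧ z) xor e)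
  distrib = solve-∀ 𝔽₂

dot-vaddʳ : ∀ {n} (s a b : V n) → dot s (vadd a b) ≡ dot s a xor dot s b
dot-vaddʳ []       []       []       = refl
dot-vaddʳ (s ∷ ss) (a ∷ as) (b ∷ bs) =
  trans (cong ((s ∧ (a xor b)) xor_) (dot-vaddʳ ss as bs)) (distrib s a b _ _)
  where
  distrib : ∀ s a b d e → (s ∧ (a xor b)) xor (d xor e) ≡ ((s ∧ a) xor d) xor ((s ∧ b) xor e)
  distrib = solve-∀ 𝔽₂

dot-scaleˡ : ∀ {n} c (m z : V n) → dot (vmap (c ∧_) m) z ≡ c ∧ dot m z
dot-scaleˡ c []       []       = sym (∧-zeroʳ c)
dot-scaleˡ c (m ∷ ms) (z ∷ zs) =
  trans (cong (((c ∧ m) ∧ z) xor_) (dot-scaleˡ c ms zs)) (distrib c m z _)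
  where
  distrib : ∀ c m z d → ((c ∧ m) ∧ z) xor (c ∧ d) ≡ c ∧ ((m ∧ z) xor d)
  distrib = solve-∀ 𝔽₂

mulV-zeros : ∀ {ℓ n} (M : Mat ℓ n) → mulV M (zeros n) ≡ zeros ℓ
mulV-zeros []      = refl
mulV-zeros (m ∷ M) = cong₂ _∷_ (dot-zerosʳ m) (mulV-zeros M)

mulV-vadd : ∀ {ℓ n} (M : Mat ℓ n) (a b : V n) → mulV M (vadd a b) ≡ vadd (mulV M a) (mulV M b)
mulV-vadd []      a b = refl
mulV-vadd (m ∷ M) a b = cong₂ _∷_ (dot-vaddʳ m a b) (mulV-vadd M a b)

vMul-zeros : ∀ {ℓ n} (M : Mat ℓ n) → vMul (zeros ℓ) M ≡ zeros n
vMul-zeros M = trans (map-cong dot-zerosˡ (transpose M)) (map-const (transpose M) false)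

consCol : ∀ {ℓ n} → V ℓ → Mat ℓ n → Mat ℓ (suc n)
consCol = zipWith _∷_

heads-consCol : ∀ {ℓ n} (y : V ℓ) (M : Mat ℓ n) → vmap head (consCol y M) ≡ y
heads-consCol []       []      = refl
heads-consCol (y ∷ ys) (m ∷ M) = cong (y ∷_) (heads-consCol ys M)

tails-consCol : ∀ {ℓ n} (y : V ℓ) (M : Mat ℓ n) → vmap tail (consCol y M) ≡ M
tails-consCol []       []      = refl
tails-consCol (y ∷ ys) (m ∷ M) = cong (m ∷_) (tails-consCol ys M)

transpose-∷ : ∀ {ℓ n} (m : V n) (M : Mat ℓ n) → transpose (m ∷ M) ≡ consCol m (transpose M)
transpose-∷ m M = sym (zipWith-is-⊛ _∷_ m (transpose M))

transpose-consCol : ∀ {ℓ n} (y : V ℓ) (M : Mat ℓ n) → transpose (consCol y M) ≡ y ∷ transpose M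
transpose-consCol []       []      = refl
transpose-consCol (y ∷ ys) (m ∷ M) = begin
  transpose ((y ∷ m) ∷ consCol ys M)             ≡⟨ transpose-∷ (y ∷ m) (consCol ys M) ⟩
  consCol (y ∷ m) (transpose (consCol ys M))     ≡⟨ cong (consCol (y ∷ m)) (transpose-consCol ys M) ⟩
  (y ∷ ys) ∷ consCol m (transpose M)             ≡⟨ cong ((y ∷ ys) ∷_) (sym (transpose-∷ m M)) ⟩
  (y ∷ ys) ∷ transpose (m ∷ M)                   ∎
  where open ≡-Reasoning

vMul-∷ : ∀ {ℓ n} s₀ (s : V ℓ) (m : V n) (M : Mat ℓ n) →
         vMul (s₀ ∷ s) (m ∷ M) ≡ vadd (vmap (s₀ ∧_) m) (vMul s M)
vMul-∷ s₀ s m M = trans (cong (vmap (dot (s₀ ∷ s))) (transpose-∷ m M)) (dot-consCol m (transpose M))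
  where
  dot-consCol : ∀ {k} (m : V k) (cols : Vec (V _) k) →
                vmap (dot (s₀ ∷ s)) (consCol m cols) ≡ vadd (vmap (s₀ ∧_) m) (vmap (dot s) cols)
  dot-consCol []      []         = refl
  dot-consCol (x ∷ m) (c ∷ cols) = cong (_ ∷_) (dot-consCol m cols)

dot-mulV : ∀ {ℓ n} (s : V ℓ) (M : Mat ℓ n) (z : V n) → dot s (mulV M z) ≡ dot (vMul s M) z
dot-mulV []       []      z = sym (trans (cong (λ v → dot v z) (vMul-zeros {0} [])) (dot-zerosˡ z))
dot-mulV (s₀ ∷ s) (m ∷ M) z = begin
  (s₀ ∧ dot m z) xor dot s (mulV M z)                ≡⟨ cong₂ _xor_ (sym (dot-scaleˡ s₀ m z)) (dot-mulV s M z) ⟩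
  dot (vmap (s₀ ∧_) m) z xor dot (vMul s M) z        ≡⟨ sym (dot-vaddˡ (vmap (s₀ ∧_) m) (vMul s M) z) ⟩
  dot (vadd (vmap (s₀ ∧_) m) (vMul s M)) z           ≡⟨ cong (λ v → dot v z) (sym (vMul-∷ s₀ s m M)) ⟩
  dot (vMul (s₀ ∷ s) (m ∷ M)) z                      ∎
  where open ≡-Reasoning

mulV-consCol-false : ∀ {ℓ n} (y : V ℓ) (M : Mat ℓ n) q → mulV (consCol y M) (false ∷ q) ≡ mulV M q
mulV-consCol-false []       []      q = refl
mulV-consCol-false (y ∷ ys) (m ∷ M) q =
  cong₂ _∷_ (cong (_xor dot m q) (∧-zeroʳ y)) (mulV-consCol-false ys M q)

mulV-consCol-true : ∀ {ℓ n} (y : V ℓ) (M : Mat ℓ n) q → mulV (consCol y M) (true ∷ q) ≡ vadd y (mulV M q)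
mulV-consCol-true []       []      q = refl
mulV-consCol-true (y ∷ ys) (m ∷ M) q =
  cong₂ _∷_ (cong (_xor dot m q) (∧-identityʳ y)) (mulV-consCol-true ys M q)

vMul-consCol : ∀ {ℓ n} (s y : V ℓ) (M : Mat ℓ n) → vMul s (consCol y M) ≡ dot s y ∷ vMul s M
vMul-consCol s y M = cong (vmap (dot s)) (transpose-consCol y M)

madd-outer-consCol-false : ∀ {ℓ n} (y a : V ℓ) (M : Mat ℓ n) b →
  madd (consCol y M) (outer a (false ∷ b)) ≡ consCol y (madd M (outer a b))
madd-outer-consCol-false []       []       []      b = refl
madd-outer-consCol-false (y ∷ ys) (a ∷ as) (m ∷ M) b = cong₂ _∷_
  (cong (_∷ vadd m (vmap (a ∧_) b)) (trans (cong (y xor_) (∧-zeroʳ a)) (xor-identityʳ y)))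
  (madd-outer-consCol-false ys as M b)

madd-outer-consCol-true : ∀ {ℓ n} (y a : V ℓ) (M : Mat ℓ n) b →
  madd (consCol y M) (outer a (true ∷ b)) ≡ consCol (vadd y a) (madd M (outer a b))
madd-outer-consCol-true []       []       []      b = refl
madd-outer-consCol-true (y ∷ ys) (a ∷ as) (m ∷ M) b = cong₂ _∷_
  (cong (λ c → (y xor c) ∷ vadd m (vmap (a ∧_) b)) (∧-identityʳ a))
  (madd-outer-consCol-true ys as M b)

module _ {A : Set} where

  sumL-cong : ∀ (xs : List A) {f g : A → ℕ} → (∀ x → f x ≡ g x) → sumL xs f ≡ sumL xs g
  sumL-cong []       f≗g = refl
  sumL-cong (x ∷ xs) f≗g = cong₂ _+_ (f≗g x) (sumL-cong xs f≗g)

  sumL-mono-≤ : ∀ (xs : List A) {f g : A → ℕ} → (∀ x → f x ≤ g x) → sumL xs f ≤ sumL xs g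
  sumL-mono-≤ []       f≤g = z≤n
  sumL-mono-≤ (x ∷ xs) f≤g = +-mono-≤ (f≤g x) (sumL-mono-≤ xs f≤g)

  sumL-zero : ∀ (xs : List A) → sumL xs (λ _ → 0) ≡ 0
  sumL-zero []       = refl
  sumL-zero (x ∷ xs) = sumL-zero xs

  sumL-+ : ∀ (xs : List A) f g → sumL xs (λ x → f x + g x) ≡ sumL xs f + sumL xs g
  sumL-+ []       f g = refl
  sumL-+ (x ∷ xs) f g =
    trans (cong ((f x + g x) +_) (sumL-+ xs f g)) (+-interchange (f x) (g x) (sumL xs f) (sumL xs g))
    where open CommSemigroupProperties +-commutativeSemigroup renaming (interchange to +-interchange)

  sumL-*ˡ : ∀ (xs : List A) k f → sumL xs (λ x → k * f x) ≡ k * sumL xs f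
  sumL-*ˡ []       k f = sym (*-zeroʳ k)
  sumL-*ˡ (x ∷ xs) k f = trans (cong ((k * f x) +_) (sumL-*ˡ xs k f)) (sym (*-distribˡ-+ k (f x) _))

  sumL-*ʳ : ∀ (xs : List A) k f → sumL xs (λ x → f x * k) ≡ sumL xs f * k
  sumL-*ʳ []       k f = refl
  sumL-*ʳ (x ∷ xs) k f = trans (cong ((f x * k) +_) (sumL-*ʳ xs k f)) (sym (*-distribʳ-+ k (f x) _))

  sumL-++ : ∀ (xs ys : List A) f → sumL (xs List.++ ys) f ≡ sumL xs f + sumL ys f
  sumL-++ []       ys f = refl
  sumL-++ (x ∷ xs) ys f = trans (cong (f x +_) (sumL-++ xs ys f)) (sym (+-assoc (f x) _ _))

  sumL-*-≤-max : A → ∀ (xs : List A) (g h : A → ℕ) → ∃ λ x → sumL xs (λ y → g y * h y) ≤ sumL xs g * h x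
  sumL-*-≤-max d []       g h = d , z≤n
  sumL-*-≤-max d (y ∷ ys) g h with sumL-*-≤-max d ys g h
  ... | x , ih = [ (λ hy≤hx → x , bound hy≤hx ≤-refl) , (λ hx≤hy → y , bound ≤-refl hx≤hy) ]′ (≤-total (h y) (h x))
    where
    bound : ∀ {m} → h y ≤ h m → h x ≤ h m → sumL (y ∷ ys) (λ z → g z * h z) ≤ sumL (y ∷ ys) g * h m
    bound hy≤hm hx≤hm = ≤-trans (+-mono-≤ (*-monoʳ-≤ (g y) hy≤hm) (≤-trans ih (*-monoʳ-≤ (sumL ys g) hx≤hm)))
                                (≤-reflexive (sym (*-distribʳ-+ _ (g y) (sumL ys g))))

module _ {A B : Set} where

  sumL-swap : ∀ (xs : List A) (ys : List B) (f : A → B → ℕ) →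
              sumL xs (λ x → sumL ys (f x)) ≡ sumL ys (λ y → sumL xs (λ x → f x y))
  sumL-swap []       ys f = sym (sumL-zero ys)
  sumL-swap (x ∷ xs) ys f =
    trans (cong (sumL ys (f x) +_) (sumL-swap xs ys f)) (sym (sumL-+ ys (f x) _))

  sumL-map : ∀ (g : A → B) (xs : List A) f → sumL (List.map g xs) f ≡ sumL xs (λ x → f (g x))
  sumL-map g []       f = refl
  sumL-map g (x ∷ xs) f = cong (f (g x) +_) (sumL-map g xs f)

  sumL-concatMap : ∀ (g : A → List B) (xs : List A) f →
                   sumL (List.concatMap g xs) f ≡ sumL xs (λ x → sumL (g x) f)
  sumL-concatMap g []       f = refl
  sumL-concatMap g (x ∷ xs) f = trans (sumL-++ (g x) _ f) (cong (sumL (g x) f +_) (sumL-concatMap g xs f))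

count-∧-positive : ∀ {A : Set} (xs : List A) k (f : A → Bool) → 0 < count xs (λ x → k ∧ f x) → k ≡ true
count-∧-positive xs true  f _   = refl
count-∧-positive xs false f 0<c = ⊥-elim (n≮0 (subst (0 <_) (sumL-zero xs) 0<c))

sumL-allV-suc : ∀ n f → sumL (allV (suc n)) f ≡ sumL (allV n) (λ v → f (false ∷ v) + f (true ∷ v))
sumL-allV-suc n f =
  trans (sumL-concatMap _ (allV n) f) (sumL-cong (allV n) (λ v → cong (f (false ∷ v) +_) (+-identityʳ _)))

sumL-allMat-suc : ∀ ℓ n f → sumL (allMat (suc ℓ) n) f ≡ sumL (allMat ℓ n) (λ M → sumL (allV n) (λ v → f (v ∷ M)))
sumL-allMat-suc ℓ n f =
  trans (sumL-concatMap _ (allMat ℓ n) f) (sumL-cong (allMat ℓ n) (λ M → sumL-map (_∷ M) (allV n) f))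

sumL-allMat-consCol : ∀ ℓ n (f : Mat ℓ (suc n) → ℕ) →
  sumL (allMat ℓ (suc n)) f ≡ sumL (allV ℓ) (λ y → sumL (allMat ℓ n) (λ M → f (consCol y M)))
sumL-allMat-consCol zero    n f = sym (+-identityʳ _)
sumL-allMat-consCol (suc ℓ) n f = begin
  sumL (allMat (suc ℓ) (suc n)) f
    ≡⟨ sumL-allMat-suc ℓ (suc n) f ⟩
  sumL (allMat ℓ (suc n)) (λ X → sumL (allV (suc n)) (λ v → f (v ∷ X)))
    ≡⟨ sumL-cong (allMat ℓ (suc n)) (λ X → sumL-allV-suc n (λ v → f (v ∷ X))) ⟩
  sumL (allMat ℓ (suc n)) (λ X → sumL (allV n) (λ v → f ((false ∷ v) ∷ X) + f ((true ∷ v) ∷ X)))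
    ≡⟨ sumL-allMat-consCol ℓ n _ ⟩
  sumL (allV ℓ) (λ y → sumL (allMat ℓ n) (λ M → sumL (allV n) (λ v →
    f ((false ∷ v) ∷ consCol y M) + f ((true ∷ v) ∷ consCol y M))))
    ≡⟨ sumL-cong (allV ℓ) (λ y → trans (sumL-cong (allMat ℓ n) (λ M → sumL-+ (allV n) _ _)) (sumL-+ (allMat ℓ n) _ _)) ⟩
  sumL (allV ℓ) (λ y → sumL (allMat ℓ n) (λ M → sumL (allV n) (λ v → f ((false ∷ v) ∷ consCol y M)))
                     + sumL (allMat ℓ n) (λ M → sumL (allV n) (λ v → f ((true ∷ v) ∷ consCol y M))))
    ≡⟨ sumL-cong (allV ℓ) (λ y → sym (cong₂ _+_ (sumL-allMat-suc ℓ n (λ M → f (consCol (false ∷ y) M)))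
                                                (sumL-allMat-suc ℓ n (λ M → f (consCol (true ∷ y) M))))) ⟩
  sumL (allV ℓ) (λ y → sumL (allMat (suc ℓ) n) (λ M → f (consCol (false ∷ y) M))
                     + sumL (allMat (suc ℓ) n) (λ M → f (consCol (true ∷ y) M)))
    ≡⟨ sym (sumL-allV-suc ℓ _) ⟩
  sumL (allV (suc ℓ)) (λ y → sumL (allMat (suc ℓ) n) (λ M → f (consCol y M)))
    ∎
  where open ≡-Reasoning

sumL-allV-select : ∀ {n} (v : V n) (P : V n → Bool) → sumL (allV n) (λ y → ind (eqV v y ∧ P y)) ≡ ind (P v)
sumL-allV-select []          P = +-identityʳ _
sumL-allV-select {suc n} (false ∷ v) P =
  trans (sumL-allV-suc n _) (trans (sumL-cong (allV n) (λ y → +-identityʳ _)) (sumL-allV-select v (P ∘ (false ∷_))))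
sumL-allV-select {suc n} (true ∷ v)  P = trans (sumL-allV-suc n _) (sumL-allV-select v (P ∘ (true ∷_)))

sumL-allV-eqV : ∀ {n} (v : V n) → sumL (allV n) (λ y → ind (eqV v y)) ≡ 1
sumL-allV-eqV v = trans (sumL-cong (allV _) (λ y → cong ind (sym (∧-identityʳ (eqV v y))))) (sumL-allV-select v _)

sumL-allV-positive : ∀ n {f : V n → ℕ} → (∀ v → 0 < f v) → 0 < sumL (allV n) f
sumL-allV-positive zero    0<f = ≤-trans (0<f []) (m≤m+n _ 0)
sumL-allV-positive (suc n) {f} 0<f = subst (0 <_) (sym (sumL-allV-suc n f))
  (sumL-allV-positive n (λ v → ≤-trans (0<f (false ∷ v)) (m≤m+n _ _)))

sumL-allMat-positive : ∀ ℓ n {f : Mat ℓ n → ℕ} → (∀ M → 0 < f M) → 0 < sumL (allMat ℓ n) f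
sumL-allMat-positive zero    n 0<f = ≤-trans (0<f []) (m≤m+n _ 0)
sumL-allMat-positive (suc ℓ) n {f} 0<f = subst (0 <_) (sym (sumL-allMat-suc ℓ n f))
  (sumL-allMat-positive ℓ n (λ M → sumL-allV-positive n (λ v → 0<f (v ∷ M))))

-- shortcodeHits, shortcodeTotal, degree2Hits and allTriples all unfold to sums of this form.
sumTriples : ∀ {ℓ n} → (Mat ℓ n → V ℓ → V n → ℕ) → ℕ
sumTriples {ℓ} {n} f = sumL (allMat ℓ n) λ M → sumL (allV ℓ) λ a → sumL (allV n) λ b → f M a b

module _ {ℓ n : ℕ} where

  sumTriples-cong : ∀ {f g : Mat ℓ n → V ℓ → V n → ℕ} → (∀ M a b → f M a b ≡ g M a b) → sumTriples f ≡ sumTriples g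
  sumTriples-cong f≗g =
    sumL-cong (allMat ℓ n) λ M → sumL-cong (allV ℓ) λ a → sumL-cong (allV n) λ b → f≗g M a b

  sumTriples-mono-≤ : ∀ {f g : Mat ℓ n → V ℓ → V n → ℕ} → (∀ M a b → f M a b ≤ g M a b) → sumTriples f ≤ sumTriples g
  sumTriples-mono-≤ f≤g =
    sumL-mono-≤ (allMat ℓ n) λ M → sumL-mono-≤ (allV ℓ) λ a → sumL-mono-≤ (allV n) λ b → f≤g M a b

  sumTriples-*ˡ : ∀ k (f : Mat ℓ n → V ℓ → V n → ℕ) → sumTriples (λ M a b → k * f M a b) ≡ k * sumTriples f
  sumTriples-*ˡ k f =
    trans (sumL-cong (allMat ℓ n) λ M → trans (sumL-cong (allV ℓ) λ a → sumL-*ˡ (allV n) k (f M a))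
                                              (sumL-*ˡ (allV ℓ) k _))
          (sumL-*ˡ (allMat ℓ n) k _)

  sumTriples-consCol : ∀ (f : Mat ℓ (suc n) → V ℓ → V (suc n) → ℕ) →
    sumTriples f ≡ sumTriples (λ M a b → sumL (allV ℓ) λ y → f (consCol y M) a (false ∷ b) + f (consCol y M) a (true ∷ b))
  sumTriples-consCol f = begin
    sumTriples f
      ≡⟨ sumL-allMat-consCol ℓ n _ ⟩
    sumL (allV ℓ) (λ y → sumL (allMat ℓ n) λ M → sumL (allV ℓ) λ a → sumL (allV (suc n)) λ b → f (consCol y M) a b)
      ≡⟨ sumL-cong (allV ℓ) (λ y → sumL-cong (allMat ℓ n) λ M → sumL-cong (allV ℓ) λ a → sumL-allV-suc n _) ⟩
    sumL (allV ℓ) (λ y → sumTriples λ M a b → g y M a b)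
      ≡⟨ sumL-swap (allV ℓ) (allMat ℓ n) _ ⟩
    sumL (allMat ℓ n) (λ M → sumL (allV ℓ) λ y → sumL (allV ℓ) λ a → sumL (allV n) λ b → g y M a b)
      ≡⟨ sumL-cong (allMat ℓ n) (λ M → trans (sumL-swap (allV ℓ) (allV ℓ) _)
                                             (sumL-cong (allV ℓ) λ a → sumL-swap (allV ℓ) (allV n) _)) ⟩
    sumTriples (λ M a b → sumL (allV ℓ) λ y → g y M a b)
      ∎
    where
    open ≡-Reasoning
    g : V ℓ → Mat ℓ n → V ℓ → V n → ℕ
    g y M a b = f (consCol y M) a (false ∷ b) + f (consCol y M) a (true ∷ b)

module _ {ℓ n : ℕ} (H : Subset ℓ (suc n)) where

  card-columnGraph : ∀ (w : Mat ℓ n → V ℓ) (P : V ℓ → Mat ℓ n → Bool) →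
    (∀ y M → H (consCol y M) ≡ eqV (w M) y ∧ P y M) → card H ≡ count (allMat ℓ n) (λ M → P (w M) M)
  card-columnGraph w P onColumn =
    trans (sumL-allMat-consCol ℓ n _) (trans (sumL-swap (allV ℓ) (allMat ℓ n) _) (sumL-cong (allMat ℓ n) λ M →
      trans (sumL-cong (allV ℓ) λ y → cong ind (onColumn y M)) (sumL-allV-select (w M) (λ y → P y M))))

  card-columnProduct : ∀ (G : V ℓ → Bool) (P : V ℓ → Mat ℓ n → Bool) →
    (∀ y M → H (consCol y M) ≡ G y ∧ P y M) → card H ≡ sumL (allV ℓ) (λ y → ind (G y) * count (allMat ℓ n) (P y))
  card-columnProduct G P onColumn =
    trans (sumL-allMat-consCol ℓ n _) (sumL-cong (allV ℓ) λ y →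
      trans (sumL-cong (allMat ℓ n) λ M → trans (cong ind (onColumn y M)) (ind-∧ (G y) (P y M)))
            (sumL-*ˡ (allMat ℓ n) (ind (G y)) _))

-- The graph of F and the shortcode test

_∩_ : ∀ {ℓ n} → Subset ℓ n → Subset ℓ n → Subset ℓ n
(S ∩ T) M = S M ∧ T M

graph : ∀ {ℓ n} → (Mat ℓ n → V ℓ) → Subset ℓ (suc n)
graph F X = eqV (F (vmap tail X)) (vmap head X)

module _ {ℓ n : ℕ} (F : Mat ℓ n → V ℓ) where

  graph-consCol : ∀ y M → graph F (consCol y M) ≡ eqV (F M) y
  graph-consCol y M = cong₂ eqV (cong F (tails-consCol y M)) (heads-consCol y M)

  count-graph-column : ∀ M → sumL (allV ℓ) (λ y → ind (graph F (consCol y M))) ≡ 1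
  count-graph-column M = trans (sumL-cong (allV ℓ) λ y → cong ind (graph-consCol y M)) (sumL-allV-eqV (F M))

  card-graph-positive : 0 < card (graph F)
  card-graph-positive = subst (0 <_) (sym card-graph) (sumL-allMat-positive ℓ n (λ _ → s≤s z≤n))
    where
    card-graph : card (graph F) ≡ sumL (allMat ℓ n) (λ _ → 1)
    card-graph = trans (sumL-allMat-consCol ℓ n _)
      (trans (sumL-swap (allV ℓ) (allMat ℓ n) _) (sumL-cong (allMat ℓ n) count-graph-column))

  shortcodeTotal-graph : shortcodeTotal (graph F) ≡ 2 * allTriples ℓ n
  shortcodeTotal-graph = begin
    shortcodeTotal (graph F)
      ≡⟨ sumTriples-consCol {ℓ} {n} _ ⟩
    sumTriples {ℓ} {n} (λ M a b → sumL (allV ℓ) λ y → ind (graph F (consCol y M)) + ind (graph F (consCol y M)))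
      ≡⟨ sumTriples-cong (λ M a b →
           trans (sumL-+ (allV ℓ) _ _) (cong₂ _+_ (count-graph-column M) (count-graph-column M))) ⟩
    sumTriples {ℓ} {n} (λ M a b → 2 * 1)
      ≡⟨ sumTriples-*ˡ {ℓ} {n} 2 (λ _ _ _ → 1) ⟩
    2 * allTriples ℓ n
      ∎
    where open ≡-Reasoning

  shortcodeHits-graph : shortcodeHits (graph F) ≡
    sumTriples (λ M a b → ind (eqV (F (madd M (outer a b))) (F M)) + ind (eqV (F (madd M (outer a b))) (vadd (F M) a)))
  shortcodeHits-graph = trans (sumTriples-consCol {ℓ} {n} _) (sumTriples-cong λ M a b →
    trans (sumL-+ (allV ℓ) _ _) (cong₂ _+_ (unshifted M a b) (shifted M a b)))
    where
    unshifted : ∀ M a b →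
      sumL (allV ℓ) (λ y → ind (graph F (consCol y M) ∧ graph F (madd (consCol y M) (outer a (false ∷ b)))))
        ≡ ind (eqV (F (madd M (outer a b))) (F M))
    unshifted M a b = trans
      (sumL-cong (allV ℓ) λ y → cong ind (cong₂ _∧_ (graph-consCol y M)
        (trans (cong (graph F) (madd-outer-consCol-false y a M b)) (graph-consCol y _))))
      (sumL-allV-select (F M) _)
    shifted : ∀ M a b →
      sumL (allV ℓ) (λ y → ind (graph F (consCol y M) ∧ graph F (madd (consCol y M) (outer a (true ∷ b)))))
        ≡ ind (eqV (F (madd M (outer a b))) (vadd (F M) a))
    shifted M a b = trans
      (sumL-cong (allV ℓ) λ y → cong ind (cong₂ _∧_ (graph-consCol y M)
        (trans (cong (graph F) (madd-outer-consCol-true y a M b)) (graph-consCol (vadd y a) _))))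
      (sumL-allV-select (F M) (λ y → eqV (F (madd M (outer a b))) (vadd y a)))

  degree2Hits≤shortcodeHits-graph : degree2Hits F ≤ shortcodeHits (graph F)
  degree2Hits≤shortcodeHits-graph =
    ≤-trans (sumTriples-mono-≤ {ℓ} {n} λ M a b → ind-∨ (eqV (F (madd M (outer a b))) (F M)) _)
            (≤-reflexive (sym shortcodeHits-graph))

  graph-passes-shortcode-test : ∀ δ → δ *ℚ ℕ→ℚ (allTriples ℓ n) ≤ℚ ℕ→ℚ (degree2Hits F) →
    (δ *ℚ ½) *ℚ ℕ→ℚ (shortcodeTotal (graph F)) ≤ℚ ℕ→ℚ (shortcodeHits (graph F))
  graph-passes-shortcode-test δ test = begin
    (δ *ℚ ½) *ℚ ℕ→ℚ (shortcodeTotal (graph F))  ≡⟨ cong (λ k → (δ *ℚ ½) *ℚ ℕ→ℚ k) shortcodeTotal-graph ⟩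
    (δ *ℚ ½) *ℚ ℕ→ℚ (2 * allTriples ℓ n)         ≡⟨ half-of-double δ (allTriples ℓ n) ⟩
    δ *ℚ ℕ→ℚ (allTriples ℓ n)                    ≤⟨ test ⟩
    ℕ→ℚ (degree2Hits F)                          ≤⟨ ℕ→ℚ-mono-≤ degree2Hits≤shortcodeHits-graph ⟩
    ℕ→ℚ (shortcodeHits (graph F))                ∎
    where open ℚ.≤-Reasoning

-- Nice sets

rightMem : ∀ {ℓ n r} → Vec (V n) r → Vec (V ℓ) r → Mat ℓ n → Bool
rightMem q t M = allB (zipWith (λ qi ti → eqV (mulV M qi) ti) q t)

leftMem : ∀ {ℓ n r} → Vec (V ℓ) r → Vec (V n) r → Mat ℓ n → Bool
leftMem s u M = allB (zipWith (λ sj uj → eqV (vMul sj M) uj) s u)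

module _ {A B : Set} (f : A → B → Bool) where

  allB-zipWith-++ : ∀ {r k} (xs : Vec A r) (ys : Vec B r) (xs′ : Vec A k) (ys′ : Vec B k) →
    allB (zipWith f (xs ++ xs′) (ys ++ ys′)) ≡ allB (zipWith f xs ys) ∧ allB (zipWith f xs′ ys′)
  allB-zipWith-++ []       []       xs′ ys′ = refl
  allB-zipWith-++ (x ∷ xs) (y ∷ ys) xs′ ys′ =
    trans (cong (f x y ∧_) (allB-zipWith-++ xs ys xs′ ys′)) (sym (∧-assoc (f x y) _ _))

  allB-zipWith-replicate : ∀ k {x y} → f x y ≡ true → allB (zipWith f (replicate k x) (replicate k y)) ≡ true
  allB-zipWith-replicate zero    _   = refl
  allB-zipWith-replicate (suc k) fxy = cong₂ _∧_ fxy (allB-zipWith-replicate k fxy)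

-- SSH asks for r > 0, so one trivial constraint 0 · M = 0 is always added.
padRight : ∀ {m r₁} r₂ → Vec (V m) r₁ → Vec (V m) (suc (r₁ + r₂))
padRight r₂ q = zeros _ ∷ q ++ replicate r₂ (zeros _)

padLeft : ∀ {m} r₁ {r₂} → Vec (V m) r₂ → Vec (V m) (suc (r₁ + r₂))
padLeft r₁ p = replicate (suc r₁) (zeros _) ++ p

condEvent-pad : ∀ {ℓ n r₁ r₂} (q : Vec (V n) r₁) (t : Vec (V ℓ) r₁) (s : Vec (V ℓ) r₂) (u : Vec (V n) r₂) M →
  condEvent (padRight r₂ q) (padRight r₂ t) (padLeft r₁ s) (padLeft r₁ u) M ≡ niceMem q t s u M
condEvent-pad {ℓ} {n} {r₁} {r₂} q t s u M = cong₂ _∧_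
  (trans (cong₂ _∧_ trivialʳ (trans (allB-zipWith-++ _ q t _ _)
                                    (cong (rightMem q t M ∧_) (allB-zipWith-replicate _ r₂ trivialʳ))))
         (∧-identityʳ _))
  (trans (allB-zipWith-++ _ (replicate (suc r₁) _) _ s u)
         (cong (_∧ leftMem s u M) (allB-zipWith-replicate _ (suc r₁) trivialˡ)))
  where
  trivialʳ : eqV (mulV M (zeros n)) (zeros ℓ) ≡ true
  trivialʳ = trans (cong (λ v → eqV v (zeros ℓ)) (mulV-zeros M)) (eqV-refl (zeros ℓ))
  trivialˡ : eqV (vMul (zeros ℓ) M) (zeros n) ≡ true
  trivialˡ = trans (cong (λ v → eqV v (zeros n)) (vMul-zeros M)) (eqV-refl (zeros n))

firstColMem : ∀ {ℓ n r} → Vec (V ℓ) r → Vec (V (suc n)) r → V ℓ → Bool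
firstColMem s u y = allB (zipWith (λ sj uj → eqB (dot sj y) (head uj)) s u)

leftMem-consCol : ∀ {ℓ n r} (s : Vec (V ℓ) r) (u : Vec (V (suc n)) r) y M →
  leftMem s u (consCol y M) ≡ firstColMem s u y ∧ leftMem s (vmap tail u) M
leftMem-consCol []       []              y M = refl
leftMem-consCol (sj ∷ s) ((u₀ ∷ u′) ∷ u) y M = begin
  eqV (vMul sj (consCol y M)) (u₀ ∷ u′) ∧ leftMem s u (consCol y M)
    ≡⟨ cong₂ _∧_ (cong (λ v → eqV v (u₀ ∷ u′)) (vMul-consCol sj y M)) (leftMem-consCol s u y M) ⟩
  (eqB (dot sj y) u₀ ∧ eqV (vMul sj M) u′) ∧ (firstColMem s u y ∧ leftMem s (vmap tail u) M)
    ≡⟨ ∧-interchange (eqB (dot sj y) u₀) (eqV (vMul sj M) u′) (firstColMem s u y) (leftMem s (vmap tail u) M) ⟩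
  (eqB (dot sj y) u₀ ∧ firstColMem s u y) ∧ (eqV (vMul sj M) u′ ∧ leftMem s (vmap tail u) M)
    ∎
  where open ≡-Reasoning

module _ {ℓ n : ℕ} where

  rightMem-consCol-noPivot : ∀ {r} {q : Vec (V (suc n)) r} (t : Vec (V ℓ) r) → All (λ qi → head qi ≡ false) q →
    ∀ y M → rightMem q t (consCol y M) ≡ rightMem (vmap tail q) t M
  rightMem-consCol-noPivot []       []           y M = refl
  rightMem-consCol-noPivot {q = (false ∷ q′) ∷ _} (ti ∷ t) (refl ∷ none) y M =
    cong₂ _∧_ (cong (λ v → eqV v ti) (mulV-consCol-false y M q′)) (rightMem-consCol-noPivot t none y M)

  niceMem-consCol-noPivot : ∀ {r₁ r₂} {q : Vec (V (suc n)) r₁} (t : Vec (V ℓ) r₁) s (u : Vec (V (suc n)) r₂) →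
    All (λ qi → head qi ≡ false) q → ∀ y M →
    niceMem q t s u (consCol y M) ≡ firstColMem s u y ∧ niceMem (vmap tail q) t s (vmap tail u) M
  niceMem-consCol-noPivot {q = q} t s u none y M =
    trans (cong₂ _∧_ (rightMem-consCol-noPivot t none y M) (leftMem-consCol s u y M))
          (∧-swap (rightMem (vmap tail q) t M) (firstColMem s u y) (leftMem s (vmap tail u) M))

  data HasPivot (z : V n) (w : V ℓ) : ∀ {r} → Vec (V (suc n)) r → Vec (V ℓ) r → Set where
    here  : ∀ {r} {q : Vec (V (suc n)) r} {t} → HasPivot z w ((true ∷ z) ∷ q) (w ∷ t)
    there : ∀ {r qi ti} {q : Vec (V (suc n)) r} {t} → HasPivot z w q t → HasPivot z w (qi ∷ q) (ti ∷ t)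

  pivot? : ∀ {r} (q : Vec (V (suc n)) r) (t : Vec (V ℓ) r) →
           (∃₂ λ z w → HasPivot z w q t) ⊎ All (λ qi → head qi ≡ false) q
  pivot? []                []      = inj₂ []
  pivot? ((true ∷ z) ∷ q)  (w ∷ t) = inj₁ (z , w , here)
  pivot? ((false ∷ _) ∷ q) (_ ∷ t) = Sum.map (λ (z , w , p) → z , w , there p) (refl ∷_) (pivot? q t)

  -- On the pivot constraint y + M z = w the first column is y = M z + w; substituting it turns
  -- every other constraint into one on M alone.
  module _ (z : V n) (w : V ℓ) where

    pivotCol : Mat ℓ n → V ℓ
    pivotCol M = vadd (mulV M z) w

    eliminateQ : ∀ {r} → Vec (V (suc n)) r → Vec (V n) r
    eliminateQ = vmap (λ qi → if head qi then vadd (tail qi) z else tail qi)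

    eliminateT : ∀ {r} → Vec (V (suc n)) r → Vec (V ℓ) r → Vec (V ℓ) r
    eliminateT = zipWith (λ qi ti → if head qi then vadd ti w else ti)

    pivotConsistent : ∀ {r} → Vec (V ℓ) r → Vec (V (suc n)) r → Bool
    pivotConsistent s u = allB (zipWith (λ sj uj → eqB (dot (tail uj) z xor dot sj w) (head uj)) s u)

    rightMem-consCol-pivotCol : ∀ {r} (q : Vec (V (suc n)) r) t M →
      rightMem q t (consCol (pivotCol M) M) ≡ rightMem (eliminateQ q) (eliminateT q t) M
    rightMem-consCol-pivotCol []                []       M = refl
    rightMem-consCol-pivotCol ((false ∷ q′) ∷ q) (ti ∷ t) M =
      cong₂ _∧_ (cong (λ v → eqV v ti) (mulV-consCol-false (pivotCol M) M q′)) (rightMem-consCol-pivotCol q t M)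
    rightMem-consCol-pivotCol ((true ∷ q′) ∷ q)  (ti ∷ t) M =
      cong₂ _∧_ (trans (cong (λ v → eqV v ti) (mulV-consCol-true (pivotCol M) M q′)) (eqV-cong-vadd substituted))
                (rightMem-consCol-pivotCol q t M)
      where
      substituted : vadd (vadd (pivotCol M) (mulV M q′)) ti ≡ vadd (mulV M (vadd q′ z)) (vadd ti w)
      substituted = sym (trans (cong (λ v → vadd v (vadd ti w)) (mulV-vadd M q′ z))
                               (vadd-shuffle (mulV M q′) (mulV M z) ti w))

    firstColMem-pivotCol : ∀ {r} (s : Vec (V ℓ) r) u M → leftMem s (vmap tail u) M ≡ true →
      firstColMem s u (pivotCol M) ≡ pivotConsistent s u
    firstColMem-pivotCol []       []              M _    = refl
    firstColMem-pivotCol (sj ∷ s) ((u₀ ∷ u′) ∷ u) M left =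
      cong₂ _∧_ (cong (λ d → eqB d u₀) dot-pivotCol) (firstColMem-pivotCol s u M (proj₂ ∧-conical _ _ left))
      where
      sjM≡u′ : vMul sj M ≡ u′
      sjM≡u′ = eqV-sound (proj₁ ∧-conical (eqV (vMul sj M) u′) (leftMem s (vmap tail u) M) left)
      dot-pivotCol : dot sj (pivotCol M) ≡ dot u′ z xor dot sj w
      dot-pivotCol = trans (dot-vaddʳ sj (mulV M z) w)
        (cong (_xor dot sj w) (trans (dot-mulV sj M z) (cong (λ v → dot v z) sjM≡u′)))

    rightMem-consCol-offPivot : ∀ {r} {q : Vec (V (suc n)) r} {t} → HasPivot z w q t →
      ∀ {y} M → eqV (pivotCol M) y ≡ false → rightMem q t (consCol y M) ≡ false
    rightMem-consCol-offPivot here {y} M off = cong (_∧ _)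
      (trans (cong (λ v → eqV v w) (mulV-consCol-true y M z)) (trans (eqV-cong-vadd (vadd-rotate y _ w)) off))
    rightMem-consCol-offPivot (there p) M off =
      trans (cong (_ ∧_) (rightMem-consCol-offPivot p M off)) (∧-zeroʳ _)

    niceMem-consCol-pivot : ∀ {r₁ r₂} {q : Vec (V (suc n)) r₁} {t} (s : Vec (V ℓ) r₂) u → HasPivot z w q t → ∀ y M →
      niceMem q t s u (consCol y M) ≡
      eqV (pivotCol M) y ∧ (pivotConsistent s u ∧ niceMem (eliminateQ q) (eliminateT q t) s (vmap tail u) M)
    niceMem-consCol-pivot {q = q} {t} s u p y M = ≡-∧-cases
      (λ on → subst (λ y → niceMem q t s u (consCol y M) ≡ pivotConsistent s u ∧ reduced)
                    (eqV-sound {a = pivotCol M} {y} on) onGraph)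
      (λ off → cong (_∧ leftMem s u (consCol y M)) (rightMem-consCol-offPivot p M off))
      where
      reduced : Bool
      reduced = niceMem (eliminateQ q) (eliminateT q t) s (vmap tail u) M
      onGraph : niceMem q t s u (consCol (pivotCol M) M) ≡ pivotConsistent s u ∧ reduced
      onGraph = trans (cong₂ _∧_ (rightMem-consCol-pivotCol q t M) (leftMem-consCol s u (pivotCol M) M))
        (trans (cong (rightMem (eliminateQ q) (eliminateT q t) M ∧_) (∧-congˡ-if (firstColMem-pivotCol s u M)))
               (∧-swap (rightMem (eliminateQ q) (eliminateT q t) M) (pivotConsistent s u) (leftMem s (vmap tail u) M)))

-- Agreement of F on nice conditions

ConditionalAgreement : ∀ {ℓ n} → ℚ → (Mat ℓ n → Bool) → (Mat ℓ n → V ℓ) → (Mat ℓ n → V ℓ) → Set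
ConditionalAgreement {ℓ} {n} ε C F w =
  (0 < count (allMat ℓ n) C) ×
  (ε *ℚ ℕ→ℚ (count (allMat ℓ n) C) ≤ℚ ℕ→ℚ (count (allMat ℓ n) (λ M → C M ∧ eqV (F M) (w M))))

conditionalAgreement-cong : ∀ {ℓ n ε F} {C C′ : Mat ℓ n → Bool} {w w′ : Mat ℓ n → V ℓ} →
  (∀ M → C M ≡ C′ M) → (∀ M → w M ≡ w′ M) → ConditionalAgreement ε C F w → ConditionalAgreement ε C′ F w′
conditionalAgreement-cong {ℓ} {n} {ε} {F} {C} {C′} C≗C′ w≗w′ (0<|C| , agree) =
  subst (0 <_) |C|≡|C′| 0<|C| ,
  subst₂ (λ c a → ε *ℚ ℕ→ℚ c ≤ℚ ℕ→ℚ a) |C|≡|C′|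
         (sumL-cong (allMat ℓ n) λ M → cong₂ (λ c v → ind (c ∧ eqV (F M) v)) (C≗C′ M) (w≗w′ M)) agree
  where
  |C|≡|C′| : count (allMat ℓ n) C ≡ count (allMat ℓ n) C′
  |C|≡|C′| = sumL-cong (allMat ℓ n) λ M → cong ind (C≗C′ M)

AffineAgreement : ∀ {ℓ n} → ℚ → ℕ → (Mat ℓ n → V ℓ) → Set
AffineAgreement {ℓ} {n} ε r F =
  Σ (Vec (V n) r) λ q → Σ (Vec (V ℓ) r) λ t →
  Σ (Vec (V ℓ) r) λ p → Σ (Vec (V n) r) λ s →
  Σ (V n) λ z → Σ (V ℓ) λ u → ConditionalAgreement ε (condEvent q t p s) F (λ M → vadd (mulV M z) u)

agreement-padded : ∀ {ℓ n r₁ r₂ ε} {F : Mat ℓ n → V ℓ}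
  (q : Vec (V n) r₁) (t : Vec (V ℓ) r₁) (s : Vec (V ℓ) r₂) (u : Vec (V n) r₂) z w →
  ConditionalAgreement ε (niceMem q t s u) F (λ M → vadd (mulV M z) w) → AffineAgreement ε (suc (r₁ + r₂)) F
agreement-padded {r₁ = r₁} {r₂} {ε} {F} q t s u z w agree =
  padRight r₂ q , padRight r₂ t , padLeft r₁ s , padLeft r₁ u , z , w ,
  conditionalAgreement-cong {ε = ε} {F} (λ M → sym (condEvent-pad q t s u M)) (λ _ → refl) agree

module _ {ℓ n} (F : Mat ℓ n → V ℓ) {ε} {T : Subset ℓ (suc n)} (0<|T| : 0 < card T)
         (dense : ε *ℚ ℕ→ℚ (card T) ≤ℚ ℕ→ℚ (card (graph F ∩ T))) where

  agreement-columnGraph : ∀ (w : Mat ℓ n → V ℓ) (C : Mat ℓ n → Bool) →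
    (∀ y M → T (consCol y M) ≡ eqV (w M) y ∧ C M) → ConditionalAgreement ε C F w
  agreement-columnGraph w C onColumn =
    density-cancelˡ {ε} 1 (count (allMat ℓ n) C) (count (allMat ℓ n) (λ M → C M ∧ eqV (F M) (w M))) 0<|T| dense
      (trans |T| (sym (*-identityˡ _))) (≤-reflexive (trans |graph∩T| (sym (*-identityˡ _))))
    where
    |T| : card T ≡ count (allMat ℓ n) C
    |T| = card-columnGraph T w (λ _ → C) onColumn
    |graph∩T| : card (graph F ∩ T) ≡ count (allMat ℓ n) (λ M → C M ∧ eqV (F M) (w M))
    |graph∩T| = card-columnGraph (graph F ∩ T) w (λ y M → C M ∧ eqV (F M) y) λ y M →
      trans (cong₂ _∧_ (graph-consCol F y M) (onColumn y M)) (∧-rotate (eqV (F M) y) (eqV (w M) y) (C M))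

  agreement-columnProduct : ∀ (G : V ℓ → Bool) (C : Mat ℓ n → Bool) →
    (∀ y M → T (consCol y M) ≡ G y ∧ C M) → ∃ λ y* → ConditionalAgreement ε C F (λ _ → y*)
  agreement-columnProduct G C onColumn = proj₁ best ,
    density-cancelˡ {ε} (count (allV ℓ) G) (count (allMat ℓ n) C) (agree (proj₁ best)) 0<|T| dense
      |T| (≤-trans (≤-reflexive |graph∩T|) (proj₂ best))
    where
    agree : V ℓ → ℕ
    agree y = count (allMat ℓ n) (λ M → C M ∧ eqV (F M) y)
    best : ∃ λ y* → sumL (allV ℓ) (λ y → ind (G y) * agree y) ≤ count (allV ℓ) G * agree y*
    best = sumL-*-≤-max (zeros ℓ) (allV ℓ) (ind ∘ G) agree
    |T| : card T ≡ count (allV ℓ) G * count (allMat ℓ n) C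
    |T| = trans (card-columnProduct T G (λ _ → C) onColumn) (sumL-*ʳ (allV ℓ) _ (ind ∘ G))
    |graph∩T| : card (graph F ∩ T) ≡ sumL (allV ℓ) (λ y → ind (G y) * agree y)
    |graph∩T| = card-columnProduct (graph F ∩ T) G (λ y M → C M ∧ eqV (F M) y) λ y M →
      trans (cong₂ _∧_ (graph-consCol F y M) (onColumn y M)) (∧-rotate (eqV (F M) y) (G y) (C M))

module _ {ℓ n r₁ r₂} (F : Mat ℓ n → V ℓ) {ε} {T : Subset ℓ (suc n)} (0<|T| : 0 < card T)
         (dense : ε *ℚ ℕ→ℚ (card T) ≤ℚ ℕ→ℚ (card (graph F ∩ T)))
         (q : Vec (V (suc n)) r₁) (t : Vec (V ℓ) r₁) (s : Vec (V ℓ) r₂) (u : Vec (V (suc n)) r₂)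
         (T≡nice : ∀ X → T X ≡ niceMem q t s u X) where

  agreement-pivot : ∀ {z w} → HasPivot z w q t → AffineAgreement ε (suc (r₁ + r₂)) F
  agreement-pivot {z} {w} p = agreement-padded {ε = ε} {F} (eliminateQ z w q) (eliminateT z w q t) s (vmap tail u) z w
    (conditionalAgreement-cong {ε = ε} {F} (λ M → cong (_∧ reduced M) consistent) (λ _ → refl) agreement)
    where
    K : Bool
    K = pivotConsistent z w s u
    reduced : Mat ℓ n → Bool
    reduced = niceMem (eliminateQ z w q) (eliminateT z w q t) s (vmap tail u)
    agreement : ConditionalAgreement ε (λ M → K ∧ reduced M) F (pivotCol z w)
    agreement = agreement-columnGraph F {ε} 0<|T| dense (pivotCol z w) (λ M → K ∧ reduced M) λ y M →
      trans (T≡nice (consCol y M)) (niceMem-consCol-pivot z w s u p y M)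
    consistent : K ≡ true
    consistent = count-∧-positive (allMat ℓ n) K reduced (proj₁ agreement)

  agreement-noPivot : All (λ qi → head qi ≡ false) q → AffineAgreement ε (suc (r₁ + r₂)) F
  agreement-noPivot none = agreement-padded {ε = ε} {F} (vmap tail q) t s (vmap tail u) (zeros n) (proj₁ best)
    (conditionalAgreement-cong {ε = ε} {F} (λ _ → refl) affine (proj₂ best))
    where
    reduced : Mat ℓ n → Bool
    reduced = niceMem (vmap tail q) t s (vmap tail u)
    best : ∃ λ y* → ConditionalAgreement ε reduced F (λ _ → y*)
    best = agreement-columnProduct F {ε} 0<|T| dense (firstColMem s u) reduced λ y M →
      trans (T≡nice (consCol y M)) (niceMem-consCol-noPivot t s u none y M)
    affine : ∀ M → proj₁ best ≡ vadd (mulV M (zeros n)) (proj₁ best)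
    affine M = sym (trans (cong (λ v → vadd v (proj₁ best)) (mulV-zeros M)) (vadd-identityˡ (proj₁ best)))

agreement-of-dense-nice : ∀ {ℓ n r} (F : Mat ℓ n → V ℓ) {ε} (T : Subset ℓ (suc n)) → IsNice r T → 0 < card T →
  ε *ℚ ℕ→ℚ (card T) ≤ℚ ℕ→ℚ (card (graph F ∩ T)) → AffineAgreement ε (suc r) F
agreement-of-dense-nice F {ε} T (r₁ , r₂ , refl , q , t , s , u , T≡nice) 0<|T| dense =
  [ (λ (_ , _ , p) → agreement-pivot F {ε} 0<|T| dense q t s u T≡nice p)
  , agreement-noPivot F {ε} 0<|T| dense q t s u T≡nice
  ]′ (pivot? q t)

theorem1 : ISH → SSH
-- The reduction works for all ℓ and n, so the threshold N is 0 and the hypothesis N ℓ ≤ n is unused.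
theorem1 ish δ 0<δ =
  let ε , 0<ε , r , inverse = ish (δ *ℚ ½) (half-positive δ 0<δ)
  in ε , 0<ε , suc r , s≤s z≤n , (λ _ → 0) , λ ℓ n _ F test →
     let T , nice , 0<|T| , dense =
           inverse ℓ (suc n) (graph F) (card-graph-positive F) (graph-passes-shortcode-test F δ test)
     in agreement-of-dense-nice F {ε} T nice 0<|T| dense
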